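{- For $j\geq0$, \[v_j\equiv 11B^{\pm}(j+1)+14B^{\pm}(j+2)+9B^{\pm}(j+3)+6B^{\pm}(j+4)+B^{\pm}(j+5)\pmod{16}.\]
   Context: $B^{\pm}(n)=\sum_{k=0}^n(-1)^kS(n,k)$ with $S(n,k)$ the Stirling numbers of the second kind. $P$ is the infinite matrix indexed by the non-negative integers with $P(r+1,r)=1$, $P(r,r)=r-1$, $P(r,r+1)=-r-1$ for $r\geq0$, and $P(r,s)=0$ for $|r-s|>1$ (and $P^0=I$). For a matrix $A$, $A_8$ is its top-left $8\times8$ submatrix. $Q$ is the unique $8\times8$ integer matrix with entries in $\{0,\dots,15\}$ such that $(P^{48})_8\equiv I+8Q\pmod{2^7}$ (all entries of $(P^{48})_8-I$ being divisible by $8$). Finally $v_j=\bigl(Q\,(P^j)_8\bigr)(0,0)$. -}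

module Defs where

open import Data.Nat as ℕ using (ℕ; zero; suc)
open import Data.Integer using (ℤ; +_; -_; _+_; _*_; _-_)
open import Data.Fin as Fin using (Fin; toℕ)
import Data.Fin
import Relation.Nullary

sumBelow : ℕ → (ℕ → ℤ) → ℤ
sumBelow zero    f = + 0
sumBelow (suc n) f = sumBelow n f + f n

S : ℕ → ℕ → ℕ
S zero    zero    = 1
S zero    (suc k) = 0
S (suc n) zero    = 0
S (suc n) (suc k) = suc k ℕ.* S n (suc k) ℕ.+ S n k

sgn : ℕ → ℤ
sgn zero    = + 1
sgn (suc k) = - sgn k

Bpm : ℕ → ℤ
Bpm n = sumBelow (suc n) (λ k → sgn k * + S n k)

P : ℕ → ℕ → ℤ
P r s with ℕ.compare r s
... | ℕ.less    _ zero     = - (+ r) - + 1      -- s = r + 1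
... | ℕ.less    _ (suc _)  = + 0
... | ℕ.equal   _          = + r - + 1
... | ℕ.greater _ zero     = + 1                -- r = s + 1
... | ℕ.greater _ (suc _)  = + 0

-- powers of P:  P^0 = I,  P^(j+1) = P^j · P.
-- (P^j · P)(r,s) = Σ_t P^j(r,t) P(t,s); since P(t,s) = 0 for t > s+1,
-- the sum is exactly over t < s+2.
δ : ℕ → ℕ → ℤ
δ r s with ℕ.compare r s
... | ℕ.equal _ = + 1
... | _         = + 0

Ppow : ℕ → ℕ → ℕ → ℤ
Ppow zero    r s = δ r s
Ppow (suc j) r s = sumBelow (suc (suc s)) (λ t → Ppow j r t * P t s)

Ppow8 : ℕ → Fin 8 → Fin 8 → ℤ
Ppow8 j a b = Ppow j (toℕ a) (toℕ b)

I8 : Fin 8 → Fin 8 → ℤ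
I8 a b = δ (toℕ a) (toℕ b)

v : (Fin 8 → Fin 8 → ℤ) → ℕ → ℤ
v Q j = sumBelow 8 (λ t → Qrow t * Ppow j t 0)
  where
    Qrow : ℕ → ℤ
    Qrow t with ℕ._<?_ t 8
    ... | Relation.Nullary.yes t<8 = Q Fin.zero (Data.Fin.fromℕ< t<8)
    ... | Relation.Nullary.no  _   = + 0

-- Row vectors are functions ℕ → ℤ and f ·P is the product with the tridiagonal P. The
-- falling-factorial rows φₖ(s) = k(k−1)⋯(k−s+1) satisfy φₖ·P = k φₖ − φₖ₊₁, which is the Stirling
-- recurrence read backwards, so row 0 of Pⁿ is Σₖ (−1)ᵏ S(n,k) φₖ and its entry 0 is B^±(n).
-- Hence both sides of the congruence are entry 0 of a row vector times P^j: v_j for the first row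
-- q of Q, and the right-hand side for g = 11 e₀P + 14 e₀P² + 9 e₀P³ + 6 e₀P⁴ + e₀P⁵. As P has
-- integer entries it suffices that q ≡ g (mod 16), and this follows from
-- 8q ≡ e₀P⁴⁸ − e₀ ≡ 8g (mod 128), the second congruence by computing row 0 of P⁴⁸.
module Submission where

open import Data.Nat as ℕ using (ℕ; zero; suc; _∸_; _<_; s≤s)
import Data.Nat.Properties as ℕ
import Data.Nat.Divisibility as ℕ
open import Data.Fin as Fin using (Fin; toℕ; fromℕ<)
open import Data.Fin.Properties using (all?; toℕ-fromℕ<)
open import Data.Integer using (ℤ; +_; -_; _+_; _*_; _-_; ∣_∣; _≤_; NonZero)
import Data.Integer.Properties as ℤ
open import Data.Integer.Divisibility using (_∣_)
import Data.Integer.Divisibility.Signed as Signed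
open import Data.Integer.Tactic.RingSolver using (solve-∀)
open import Algebra.Properties.AbelianGroup ℤ.+-0-abelianGroup using () renaming (∙-cancelˡ to +-cancelˡ)
open import Data.Empty using (⊥-elim)
open import Data.List using (List; []; _∷_; applyUpTo)
open import Data.Product using (_,_)
open import Data.Sum using (inj₁; inj₂)
open import Data.Unit using (tt)
open import Function using (_∘_)
open import Relation.Nullary using (yes; no)
open import Relation.Nullary.Decidable using (toWitness)
open import Relation.Binary.PropositionalEquality
  using (_≡_; refl; sym; trans; cong; cong₂; subst; subst₂; _≗_; module ≡-Reasoning)
open ≡-Reasoning

open import Defs

compare-< : ∀ m k → ℕ.compare m (suc (m ℕ.+ k)) ≡ ℕ.less m k
compare-< zero    k = refl
compare-< (suc m) k rewrite compare-< m k = refl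

compare-≡ : ∀ m → ℕ.compare m m ≡ ℕ.equal m
compare-≡ zero    = refl
compare-≡ (suc m) rewrite compare-≡ m = refl

compare-> : ∀ m k → ℕ.compare (suc (m ℕ.+ k)) m ≡ ℕ.greater m k
compare-> zero    k = refl
compare-> (suc m) k rewrite compare-> m k = refl

δ-diagonal : ∀ r → δ r r ≡ + 1
δ-diagonal r rewrite compare-≡ r = refl

δ-above : ∀ {r s} → r < s → δ r s ≡ + 0
δ-above {r} r<s with ℕ.m≤n⇒∃[o]m+o≡n r<s
... | o , refl rewrite compare-< r o = refl

δ-below : ∀ {r s} → s < r → δ r s ≡ + 0
δ-below {s = s} s<r with ℕ.m≤n⇒∃[o]m+o≡n s<r
... | o , refl rewrite compare-> s o = refl

P-diagonal : ∀ r → P r r ≡ + r - + 1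
P-diagonal r rewrite compare-≡ r = refl

P-superdiagonal : ∀ r → P r (suc r) ≡ - (+ r) - + 1
P-superdiagonal r = subst (λ s → P r (suc s) ≡ - (+ r) - + 1) (ℕ.+-identityʳ r) P-r-[1+r+0]
  where
  P-r-[1+r+0] : P r (suc (r ℕ.+ 0)) ≡ - (+ r) - + 1
  P-r-[1+r+0] rewrite compare-< r 0 = refl

P-subdiagonal : ∀ r → P (suc r) r ≡ + 1
P-subdiagonal r = subst (λ s → P (suc s) r ≡ + 1) (ℕ.+-identityʳ r) P-[1+r+0]-r
  where
  P-[1+r+0]-r : P (suc (r ℕ.+ 0)) r ≡ + 1
  P-[1+r+0]-r rewrite compare-> r 0 = refl

P-above-superdiagonal : ∀ {r s} → r < s → P r (suc s) ≡ + 0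
P-above-superdiagonal {r} r<s with ℕ.m≤n⇒∃[o]m+o≡n r<s
... | o , refl rewrite sym (ℕ.+-suc r o) | compare-< r (suc o) = refl

sumBelow-cong : ∀ n {f g : ℕ → ℤ} → f ≗ g → sumBelow n f ≡ sumBelow n g
sumBelow-cong zero    f≗g = refl
sumBelow-cong (suc n) f≗g = cong₂ _+_ (sumBelow-cong n f≗g) (f≗g n)

sumBelow-vanishing : ∀ n {f : ℕ → ℤ} → (∀ k → k < n → f k ≡ + 0) → sumBelow n f ≡ + 0
sumBelow-vanishing zero    f≡0 = refl
sumBelow-vanishing (suc n) f≡0
  rewrite sumBelow-vanishing n (λ k k<n → f≡0 k (ℕ.m<n⇒m<1+n k<n)) | f≡0 n ℕ.≤-refl = refl

sumBelow-head : ∀ n (f : ℕ → ℤ) → sumBelow (suc n) f ≡ f 0 + sumBelow n (f ∘ suc)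
sumBelow-head zero    f = ℤ.+-comm (+ 0) (f 0)
sumBelow-head (suc n) f = trans (cong (_+ f (suc n)) (sumBelow-head n f)) (ℤ.+-assoc (f 0) _ _)

sumBelow-shift : ∀ n (f : ℕ → ℤ) → f 0 ≡ f n → sumBelow n (f ∘ suc) ≡ sumBelow n f
sumBelow-shift n f f0≡fn = +-cancelˡ (f 0) _ _ (begin
  f 0 + sumBelow n (f ∘ suc)  ≡⟨ sym (sumBelow-head n f) ⟩
  sumBelow n f + f n          ≡⟨ cong (λ x → sumBelow n f + x) (sym f0≡fn) ⟩
  sumBelow n f + f 0          ≡⟨ ℤ.+-comm (sumBelow n f) (f 0) ⟩
  f 0 + sumBelow n f          ∎)

sumBelow-sub : ∀ n (f g : ℕ → ℤ) → sumBelow n (λ k → f k - g k) ≡ sumBelow n f - sumBelow n g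
sumBelow-sub zero    f g = refl
sumBelow-sub (suc n) f g =
  trans (cong (_+ (f n - g n)) (sumBelow-sub n f g)) (interchange (sumBelow n f) (sumBelow n g) (f n) (g n))
  where
  interchange : ∀ a b c d → a - b + (c - d) ≡ a + c - (b + d)
  interchange = solve-∀

infixl 7 _·P _·P^_

-- At s = 0 the junk value f (0 ∸ 1) = f 0 is multiplied by 0.
_·P : (ℕ → ℤ) → ℕ → ℤ
(f ·P) s = - (+ s) * f (s ∸ 1) + (+ s - + 1) * f s + f (suc s)

sumBelow-*P≡·P : ∀ (f : ℕ → ℤ) s → sumBelow (suc (suc s)) (λ t → f t * P t s) ≡ (f ·P) s
sumBelow-*P≡·P f zero = column₀ (f 0) (f 1)
  where
  column₀ : ∀ a b → + 0 + a * (+ 0 - + 1) + b * + 1 ≡ - (+ 0) * a + (+ 0 - + 1) * a + b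
  column₀ = solve-∀
-- The identities are stated with + 1 + S so that, at S = + s, they compute to the + suc s of the goal.
sumBelow-*P≡·P f (suc s)
  rewrite sumBelow-vanishing s {λ t → f t * P t (suc s)}
            (λ t t<s → trans (cong (f t *_) (P-above-superdiagonal t<s)) (ℤ.*-zeroʳ (f t)))
        | P-superdiagonal s | P-diagonal (suc s) | P-subdiagonal (suc s)
  = column (+ s) (f s) (f (suc s)) (f (suc (suc s)))
  where
  column : ∀ S a b c → + 0 + a * (- S - + 1) + b * (+ 1 + S - + 1) + c * + 1
                       ≡ - (+ 1 + S) * a + (+ 1 + S - + 1) * b + c
  column = solve-∀

·P-cong : ∀ {f g : ℕ → ℤ} → f ≗ g → f ·P ≗ g ·P
·P-cong {f} {g} f≗g s rewrite f≗g (s ∸ 1) | f≗g s | f≗g (suc s) = refl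

·P-linear : ∀ n (c : ℕ → ℤ) (f : ℕ → ℕ → ℤ) →
            (λ u → sumBelow n (λ t → c t * f t u)) ·P ≗ (λ s → sumBelow n (λ t → c t * (f t ·P) s))
·P-linear zero    c f s = zero-row (+ s)
  where
  zero-row : ∀ S → - S * + 0 + (S - + 1) * + 0 + + 0 ≡ + 0
  zero-row = solve-∀
·P-linear (suc n) c f s = trans
  (add-scaled (+ s) (A (s ∸ 1)) (A s) (A (suc s)) (c n) (f n (s ∸ 1)) (f n s) (f n (suc s)))
  (cong (_+ c n * (f n ·P) s) (·P-linear n c f s))
  where
  A : ℕ → ℤ
  A u = sumBelow n (λ t → c t * f t u)
  add-scaled : ∀ S a₀ a₁ a₂ k b₀ b₁ b₂ →
    - S * (a₀ + k * b₀) + (S - + 1) * (a₁ + k * b₁) + (a₂ + k * b₂)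
    ≡ - S * a₀ + (S - + 1) * a₁ + a₂ + k * (- S * b₀ + (S - + 1) * b₁ + b₂)
  add-scaled = solve-∀

·P-congruent : ∀ m {f g : ℕ → ℤ} → (∀ u → m ∣ f u - g u) → ∀ s → m ∣ (f ·P) s - (g ·P) s
·P-congruent m {f} {g} m∣f-g s = Signed.∣⇒∣ᵤ (subst (Signed._∣_ m) (sym difference)
  (Signed.∣m∣n⇒∣m+n (Signed.∣m∣n⇒∣m+n (Signed.∣n⇒∣m*n (- (+ s)) (m∣ (s ∸ 1)))
                                        (Signed.∣n⇒∣m*n (+ s - + 1) (m∣ s)))
                     (m∣ (suc s))))
  where
  m∣ : ∀ u → Signed._∣_ m (f u - g u)
  m∣ u = Signed.∣ᵤ⇒∣ (m∣f-g u)
  sub : ∀ S a₀ a₁ a₂ b₀ b₁ b₂ →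
    (- S * a₀ + (S - + 1) * a₁ + a₂) - (- S * b₀ + (S - + 1) * b₁ + b₂)
    ≡ - S * (a₀ - b₀) + (S - + 1) * (a₁ - b₁) + (a₂ - b₂)
  sub = solve-∀
  difference : (f ·P) s - (g ·P) s ≡ ((λ u → f u - g u) ·P) s
  difference = sub (+ s) (f (s ∸ 1)) (f s) (f (suc s)) (g (s ∸ 1)) (g s) (g (suc s))

_·P^_ : (ℕ → ℤ) → ℕ → ℕ → ℤ
f ·P^ zero  = f
f ·P^ suc j = f ·P^ j ·P

·P^-cong : ∀ {f g : ℕ → ℤ} → f ≗ g → ∀ j → f ·P^ j ≗ g ·P^ j
·P^-cong f≗g zero    = f≗g
·P^-cong f≗g (suc j) = ·P-cong (·P^-cong f≗g j)

·P^-linear : ∀ n (c : ℕ → ℤ) (f : ℕ → ℕ → ℤ) j →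
             (λ u → sumBelow n (λ t → c t * f t u)) ·P^ j ≗ (λ s → sumBelow n (λ t → c t * (f t ·P^ j) s))
·P^-linear n c f zero    s = refl
·P^-linear n c f (suc j) s = trans (·P-cong (·P^-linear n c f j) s) (·P-linear n c (λ t → f t ·P^ j) s)

·P^-congruent : ∀ m {f g : ℕ → ℤ} → (∀ u → m ∣ f u - g u) → ∀ j s → m ∣ (f ·P^ j) s - (g ·P^ j) s
·P^-congruent m m∣f-g zero    = m∣f-g
·P^-congruent m m∣f-g (suc j) = ·P-congruent m (·P^-congruent m m∣f-g j)

Ppow-+ : ∀ j k r → Ppow (j ℕ.+ k) r ≗ Ppow k r ·P^ j
Ppow-+ zero    k r s = refl
Ppow-+ (suc j) k r s = trans (sumBelow-*P≡·P (Ppow (j ℕ.+ k) r) s) (·P-cong (Ppow-+ j k r) s)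

S-vanishing : ∀ {n k} → n < k → S n k ≡ 0
S-vanishing {zero}  {suc k} _ = refl
S-vanishing {suc n} {suc k} (s≤s n<k)
  rewrite S-vanishing (ℕ.m<n⇒m<1+n n<k) | S-vanishing n<k = trans (ℕ.+-identityʳ _) (ℕ.*-zeroʳ k)

falling : ℕ → ℕ → ℤ
falling k zero    = + 1
falling k (suc s) = falling k s * (+ k - + s)

falling-zero : ∀ s → falling 0 (suc s) ≡ + 0
falling-zero zero    = refl
falling-zero (suc s) = cong (_* (+ 0 - + suc s)) (falling-zero s)

falling-suc : ∀ k s → falling (suc k) (suc s) ≡ + suc k * falling k s
falling-suc k zero    = identity (+ k)
  where
  identity : ∀ K → + 1 * (+ 1 + K - + 0) ≡ (+ 1 + K) * + 1
  identity = solve-∀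
falling-suc k (suc s) = trans (cong (_* (+ suc k - + suc s)) (falling-suc k s)) (identity (+ k) (+ s) (falling k s))
  where
  identity : ∀ K S X → (+ 1 + K) * X * (+ 1 + K - (+ 1 + S)) ≡ (+ 1 + K) * (X * (K - S))
  identity = solve-∀

falling-·P : ∀ k s → (falling k ·P) s ≡ + k * falling k s - falling (suc k) s
falling-·P k zero    = identity (+ k)
  where
  identity : ∀ K → - (+ 0) * + 1 + (+ 0 - + 1) * + 1 + + 1 * (K - + 0) ≡ K * + 1 - + 1
  identity = solve-∀
falling-·P k (suc s) =
  trans (identity (+ k) (+ s) (falling k s)) (cong (λ x → + k * falling k (suc s) - x) (sym (falling-suc k s)))
  where
  identity : ∀ K S X → - (+ 1 + S) * X + (+ 1 + S - + 1) * (X * (K - S)) + X * (K - S) * (K - (+ 1 + S))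
                       ≡ K * (X * (K - S)) - (+ 1 + K) * X
  identity = solve-∀

stirlingRow : ℕ → ℕ → ℤ
stirlingRow n s = sumBelow (suc n) (λ k → sgn k * + S n k * falling k s)

stirlingRow-suc : ∀ n → stirlingRow (suc n) ≗ stirlingRow n ·P
stirlingRow-suc n s = begin
  sumBelow (suc (suc n)) (λ k → sgn k * + S (suc n) k * φ k)
    ≡⟨ sumBelow-head (suc n) _ ⟩
  + 0 + sumBelow (suc n) (λ k → sgn (suc k) * + S (suc n) (suc k) * φ (suc k))
    ≡⟨ ℤ.+-identityˡ _ ⟩
  sumBelow (suc n) (λ k → sgn (suc k) * + S (suc n) (suc k) * φ (suc k))
    ≡⟨ sumBelow-cong (suc n) stirling-recurrence ⟩
  sumBelow (suc n) (λ k → x (suc k) - y k)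
    ≡⟨ sumBelow-sub (suc n) (x ∘ suc) y ⟩
  sumBelow (suc n) (x ∘ suc) - sumBelow (suc n) y
    ≡⟨ cong (_- sumBelow (suc n) y) (sumBelow-shift (suc n) x (sym x-top)) ⟩
  sumBelow (suc n) x - sumBelow (suc n) y
    ≡⟨ sym (sumBelow-sub (suc n) x y) ⟩
  sumBelow (suc n) (λ k → x k - y k)
    ≡⟨ sumBelow-cong (suc n) x-y≡a·φ·P ⟩
  sumBelow (suc n) (λ k → a k * (falling k ·P) s)
    ≡⟨ sym (·P-linear (suc n) a falling s) ⟩
  (stirlingRow n ·P) s ∎
  where
  φ : ℕ → ℤ
  φ k = falling k s
  a : ℕ → ℤ
  a k = sgn k * + S n k
  x : ℕ → ℤ
  x k = + k * (a k * φ k)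
  y : ℕ → ℤ
  y k = a k * φ (suc k)
  x-top : x (suc n) ≡ + 0
  x-top = trans (cong (λ z → + suc n * (sgn (suc n) * + z * φ (suc n))) (S-vanishing {n} ℕ.≤-refl))
                (trans (cong (λ z → + suc n * (z * φ (suc n))) (ℤ.*-zeroʳ (sgn (suc n)))) (ℤ.*-zeroʳ (+ suc n)))
  *-sub : ∀ A K X Y → A * (K * X - Y) ≡ K * (A * X) - A * Y
  *-sub = solve-∀
  x-y≡a·φ·P : ∀ k → x k - y k ≡ a k * (falling k ·P) s
  x-y≡a·φ·P k = sym (trans (cong (a k *_) (falling-·P k s)) (*-sub (a k) (+ k) (φ k) (φ (suc k))))
  split : ∀ σ K S₁ S₀ F → - σ * (K * S₁ + S₀) * F ≡ K * (- σ * S₁ * F) - σ * S₀ * F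
  split = solve-∀
  stirling-recurrence : ∀ k → sgn (suc k) * + S (suc n) (suc k) * φ (suc k) ≡ x (suc k) - y k
  stirling-recurrence k = trans
    (cong (λ z → - sgn k * z * φ (suc k))
          (trans (ℤ.pos-+ (suc k ℕ.* S n (suc k)) (S n k)) (cong (_+ + S n k) (ℤ.pos-* (suc k) (S n (suc k))))))
    (split (sgn k) (+ suc k) (+ S n (suc k)) (+ S n k) (φ (suc k)))

stirlingRow≗Ppow : ∀ n → stirlingRow n ≗ Ppow n 0
stirlingRow≗Ppow zero    zero    = refl
stirlingRow≗Ppow zero    (suc s) = cong (λ z → + 0 + + 1 * + 1 * z) (falling-zero s)
stirlingRow≗Ppow (suc n) s =
  trans (stirlingRow-suc n s) (trans (·P-cong (stirlingRow≗Ppow n) s) (sym (sumBelow-*P≡·P (Ppow n 0) s)))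

Bpm≡Ppow : ∀ n → Bpm n ≡ Ppow n 0 0
Bpm≡Ppow n = trans (sumBelow-cong (suc n) (λ k → sym (ℤ.*-identityʳ _))) (stirlingRow≗Ppow n 0)

entry : List ℤ → ℕ → ℤ
entry []       _       = + 0
entry (x ∷ _)  zero    = x
entry (_ ∷ xs) (suc i) = entry xs i

entry-applyUpTo-< : ∀ (f : ℕ → ℤ) {n i} → i < n → entry (applyUpTo f n) i ≡ f i
entry-applyUpTo-< f {suc n} {zero}  _         = refl
entry-applyUpTo-< f {suc n} {suc i} (s≤s i<n) = entry-applyUpTo-< (f ∘ suc) i<n

entry-applyUpTo-≥ : ∀ (f : ℕ → ℤ) {n i} → n ℕ.≤ i → entry (applyUpTo f n) i ≡ + 0
entry-applyUpTo-≥ f {zero}  _         = refl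
entry-applyUpTo-≥ f {suc n} (s≤s n≤i) = entry-applyUpTo-≥ (f ∘ suc) n≤i

-- Row 0 of P^n as a list. Unlike Ppow, whose recursion recomputes every entry, it can be evaluated for n = 48.
row : ℕ → List ℤ
row zero    = + 1 ∷ []
row (suc n) = applyUpTo (entry (row n) ·P) (suc (suc n))

row-vanishing : ∀ n {i} → n < i → entry (row n) i ≡ + 0
row-vanishing zero    {suc i} _   = refl
row-vanishing (suc n)         n<i = entry-applyUpTo-≥ (entry (row n) ·P) n<i

·P-vanishing : ∀ (f : ℕ → ℤ) s → f (s ∸ 1) ≡ + 0 → f s ≡ + 0 → f (suc s) ≡ + 0 → (f ·P) s ≡ + 0
·P-vanishing f s f₀ f₁ f₂ rewrite f₀ | f₁ | f₂ = zero-row (+ s)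
  where
  zero-row : ∀ S → - S * + 0 + (S - + 1) * + 0 + + 0 ≡ + 0
  zero-row = solve-∀

row-suc : ∀ n → entry (row (suc n)) ≗ entry (row n) ·P
row-suc n s with s ℕ.<? suc (suc n)
... | yes s<n+2 = entry-applyUpTo-< (entry (row n) ·P) s<n+2
... | no  s≮n+2 = trans (entry-applyUpTo-≥ (entry (row n) ·P) n+2≤s) (sym (·P-vanishing (entry (row n)) s
      (row-vanishing n (ℕ.∸-monoˡ-≤ 1 n+2≤s))
      (row-vanishing n (ℕ.<⇒≤ n+2≤s))
      (row-vanishing n (ℕ.m<n⇒m<1+n (ℕ.<⇒≤ n+2≤s)))))
  where
  n+2≤s : suc (suc n) ℕ.≤ s
  n+2≤s = ℕ.≮⇒≥ s≮n+2

row≗Ppow : ∀ n → entry (row n) ≗ Ppow n 0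
row≗Ppow zero    zero    = refl
row≗Ppow zero    (suc s) = refl
row≗Ppow (suc n) s =
  trans (row-suc n s) (trans (·P-cong (row≗Ppow n) s) (sym (sumBelow-*P≡·P (Ppow n 0) s)))

sumBelow-*δ-≥ : ∀ n (a : ℕ → ℤ) {u} → n ℕ.≤ u → sumBelow n (λ t → a t * δ t u) ≡ + 0
sumBelow-*δ-≥ n a n≤u =
  sumBelow-vanishing n (λ t t<n → trans (cong (a t *_) (δ-above (ℕ.<-≤-trans t<n n≤u))) (ℤ.*-zeroʳ (a t)))

sumBelow-*δ-< : ∀ n (a : ℕ → ℤ) {u} → u < n → sumBelow n (λ t → a t * δ t u) ≡ a u
sumBelow-*δ-< (suc n) a {u} u<1+n with ℕ.m<1+n⇒m<n∨m≡n u<1+n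
... | inj₁ u<n  = trans
  (cong₂ _+_ (sumBelow-*δ-< n a u<n) (trans (cong (a n *_) (δ-below u<n)) (ℤ.*-zeroʳ (a n))))
  (ℤ.+-identityʳ (a u))
... | inj₂ refl = trans
  (cong₂ _+_ (sumBelow-*δ-≥ u a ℕ.≤-refl) (trans (cong (a u *_) (δ-diagonal u)) (ℤ.*-identityʳ (a u))))
  (ℤ.+-identityˡ (a u))

sumBelow-*δ : ∀ n {a : ℕ → ℤ} → (∀ {t} → n ℕ.≤ t → a t ≡ + 0) →
              (λ u → sumBelow n (λ t → a t * δ t u)) ≗ a
sumBelow-*δ n {a} a≡0 u with u ℕ.<? n
... | yes u<n = sumBelow-*δ-< n a u<n
... | no  u≮n = trans (sumBelow-*δ-≥ n a (ℕ.≮⇒≥ u≮n)) (sym (a≡0 (ℕ.≮⇒≥ u≮n)))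

-- The local function Qrow in the definition of v: the first row of Q, padded with zeros.
firstRow : (Fin 8 → Fin 8 → ℤ) → ℕ → ℤ
firstRow Q t with t ℕ.<? 8
... | yes t<8 = Q Fin.zero (fromℕ< t<8)
... | no  _   = + 0

firstRow-vanishing : ∀ Q {t} → 8 ℕ.≤ t → firstRow Q t ≡ + 0
firstRow-vanishing Q {t} 8≤t with t ℕ.<? 8
... | yes t<8 = ⊥-elim (ℕ.<⇒≱ t<8 8≤t)
... | no  _   = refl

v≡firstRow·P^ : ∀ Q j → v Q j ≡ (firstRow Q ·P^ j) 0
v≡firstRow·P^ Q j = begin
  sumBelow 8 (λ t → firstRow Q t * Ppow j t 0)
    ≡⟨ sumBelow-cong 8 (λ t → cong (firstRow Q t *_) (Ppow≡δ·P^ t)) ⟩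
  sumBelow 8 (λ t → firstRow Q t * (δ t ·P^ j) 0)
    ≡⟨ sym (·P^-linear 8 (firstRow Q) δ j 0) ⟩
  ((λ u → sumBelow 8 (λ t → firstRow Q t * δ t u)) ·P^ j) 0
    ≡⟨ ·P^-cong (sumBelow-*δ 8 (firstRow-vanishing Q)) j 0 ⟩
  (firstRow Q ·P^ j) 0 ∎
  where
  Ppow≡δ·P^ : ∀ t → Ppow j t 0 ≡ (δ t ·P^ j) 0
  Ppow≡δ·P^ t = subst (λ m → Ppow m t 0 ≡ (δ t ·P^ j) 0) (ℕ.+-identityʳ j) (Ppow-+ j 0 t 0)

coefficient : ℕ → ℤ
coefficient 0 = + 11
coefficient 1 = + 14
coefficient 2 = + 9
coefficient 3 = + 6
coefficient _ = + 1

combination : ℕ → ℤ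
combination u = sumBelow 5 (λ i → coefficient i * entry (row (suc i)) u)

combination-vanishing : ∀ {u} → 8 ℕ.≤ u → combination u ≡ + 0
combination-vanishing 8≤u = sumBelow-vanishing 5 (λ i i<5 → trans
  (cong (coefficient i *_) (row-vanishing (suc i) (ℕ.<-≤-trans (s≤s i<5) (ℕ.≤-trans (ℕ.m≤m+n 6 2) 8≤u))))
  (ℤ.*-zeroʳ (coefficient i)))

combination-·P^ : ∀ j → + 11 * Bpm (j ℕ.+ 1) + + 14 * Bpm (j ℕ.+ 2) + + 9 * Bpm (j ℕ.+ 3)
                        + + 6 * Bpm (j ℕ.+ 4) + Bpm (j ℕ.+ 5) ≡ (combination ·P^ j) 0
combination-·P^ j = begin
  + 11 * Bpm (j ℕ.+ 1) + + 14 * Bpm (j ℕ.+ 2) + + 9 * Bpm (j ℕ.+ 3) + + 6 * Bpm (j ℕ.+ 4) + Bpm (j ℕ.+ 5)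
    ≡⟨ as-sum (Bpm (j ℕ.+ 1)) (Bpm (j ℕ.+ 2)) (Bpm (j ℕ.+ 3)) (Bpm (j ℕ.+ 4)) (Bpm (j ℕ.+ 5)) ⟩
  sumBelow 5 (λ i → coefficient i * Bpm (j ℕ.+ suc i))
    ≡⟨ sumBelow-cong 5 (λ i → cong (coefficient i *_) (Bpm≡row·P^ (suc i))) ⟩
  sumBelow 5 (λ i → coefficient i * (entry (row (suc i)) ·P^ j) 0)
    ≡⟨ sym (·P^-linear 5 coefficient (λ i → entry (row (suc i))) j 0) ⟩
  (combination ·P^ j) 0 ∎
  where
  as-sum : ∀ b₁ b₂ b₃ b₄ b₅ → + 11 * b₁ + + 14 * b₂ + + 9 * b₃ + + 6 * b₄ + b₅
                               ≡ + 0 + + 11 * b₁ + + 14 * b₂ + + 9 * b₃ + + 6 * b₄ + + 1 * b₅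
  as-sum = solve-∀
  Bpm≡row·P^ : ∀ k → Bpm (j ℕ.+ k) ≡ (entry (row k) ·P^ j) 0
  Bpm≡row·P^ k = trans (Bpm≡Ppow (j ℕ.+ k)) (trans (Ppow-+ j k 0 0) (·P^-cong (λ u → sym (row≗Ppow k u)) j 0))

row48-congruence : ∀ c → + 128 ∣ entry (row 48) (toℕ c) - (I8 Fin.zero c + + 8 * combination (toℕ c))
row48-congruence = toWitness {a? = all? λ c →
  128 ℕ.∣? ∣ entry (row 48) (toℕ c) - (I8 Fin.zero c + + 8 * combination (toℕ c)) ∣} tt

∣-cancel-offset : ∀ k m N d x y .{{_ : NonZero k}} →
                  k * m ∣ N - (d + k * x) → k * m ∣ N - (d + k * y) → m ∣ y - x
∣-cancel-offset k m N d x y km∣x km∣y = Signed.∣⇒∣ᵤ (Signed.*-cancelˡ-∣ k km∣k[y-x])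
  where
  difference : ∀ N d x y k → N - (d + k * x) - (N - (d + k * y)) ≡ k * (y - x)
  difference = solve-∀
  km∣k[y-x] : Signed._∣_ (k * m) (k * (y - x))
  km∣k[y-x] = subst (Signed._∣_ (k * m)) (difference N d x y k)
    (Signed.∣m∣n⇒∣m-n (Signed.∣ᵤ⇒∣ {k * m} {N - (d + k * x)} km∣x)
                      (Signed.∣ᵤ⇒∣ {k * m} {N - (d + k * y)} km∣y))

Qrow-congruent : ∀ (Q : Fin 8 → Fin 8 → ℤ) →
                 (∀ c → + 128 ∣ Ppow8 48 Fin.zero c - (I8 Fin.zero c + + 8 * Q Fin.zero c)) →
                 ∀ c → + 16 ∣ Q Fin.zero c - combination (toℕ c)
Qrow-congruent Q H c =
  ∣-cancel-offset (+ 8) (+ 16) (entry (row 48) (toℕ c)) (I8 Fin.zero c) (combination (toℕ c)) (Q Fin.zero c)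
    (row48-congruence c)
    (subst (λ N → + 128 ∣ N - (I8 Fin.zero c + + 8 * Q Fin.zero c)) (Ppow8≡row 48 c) (H c))
  where
  -- Stated for a variable j: unifying with Ppow8 48 would make Agda unfold the exponential recursion of Ppow.
  Ppow8≡row : ∀ j c → Ppow8 j Fin.zero c ≡ entry (row j) (toℕ c)
  Ppow8≡row j c = sym (row≗Ppow j (toℕ c))

firstRow-congruent : ∀ Q → (∀ c → + 16 ∣ Q Fin.zero c - combination (toℕ c)) →
                     ∀ u → + 16 ∣ firstRow Q u - combination u
firstRow-congruent Q Qrow≡g u with u ℕ.<? 8
... | yes u<8 =
  subst (λ w → + 16 ∣ Q Fin.zero (fromℕ< u<8) - combination w) (toℕ-fromℕ< u<8) (Qrow≡g (fromℕ< u<8))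
... | no  u≮8 = subst (λ z → + 16 ∣ + 0 - z) (sym (combination-vanishing (ℕ.≮⇒≥ u≮8))) (16 ℕ.∣0)

lemma6p1 : (Q : Fin 8 → Fin 8 → ℤ) →
           (∀ a b → + 0 ≤ Q a b) → (∀ a b → Q a b ≤ + 15) →
           (∀ a b → + 128 ∣ (Ppow8 48 a b - (I8 a b + + 8 * Q a b))) →
           (j : ℕ) →
           + 16 ∣ (v Q j - (+ 11 * Bpm (j ℕ.+ 1) + + 14 * Bpm (j ℕ.+ 2) + + 9 * Bpm (j ℕ.+ 3)
                            + + 6 * Bpm (j ℕ.+ 4) + Bpm (j ℕ.+ 5)))
lemma6p1 Q _ _ H j = subst₂ (λ a b → + 16 ∣ a - b) (sym (v≡firstRow·P^ Q j)) (sym (combination-·P^ j))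
  (·P^-congruent (+ 16) (firstRow-congruent Q (Qrow-congruent Q (H Fin.zero))) j 0)
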